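{- Let $r \geq 3$, let $G$ be a graph with $\delta(G) \geq \frac{r-1}{r}|V(G)| + 2$, let $v \in V(G)$, let $K \subseteq N(v)$ be an $r$-clique, let $x \in K$, and let $uw \in E(G)$ with $u, w \in N(v)$. Then there is a sequence of $r$-cliques $K_1, \dots, K_m \subseteq N(v)$ such that $K_1 = K$, $u, w \in K_m$, $x \in K_i$ for all $1 \leq i \leq m-2$, and $|K_i \cap K_{i+1}| = r-2$ for every $1 \leq i \leq m-1$.
   Context: $N(v)$ denotes the neighborhood of $v$; cliques are identified with their vertex sets. -}

module Defs where

open import Data.Nat using (ℕ; _+_; _*_; _∸_; _≤_; _<_)
open import Data.Fin using (Fin)
open import Data.Fin.Subset using (Subset; _∈_; _⊆_; _∩_; ∣_∣)
open import Data.Vec using (tabulate)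
open import Relation.Nullary using (¬_; Dec; does)
open import Relation.Binary.PropositionalEquality using (_≡_; _≢_)
open import Data.Product using (Σ; _×_)

record Graph (n : ℕ) : Set₁ where
  field
    Adj     : Fin n → Fin n → Set
    adj?    : ∀ a b → Dec (Adj a b)
    sym     : ∀ {a b} → Adj a b → Adj b a
    irrefl  : ∀ {a} → ¬ Adj a a

module _ {n : ℕ} (G : Graph n) where
  open Graph G

  N : Fin n → Subset n
  N v = tabulate (λ a → does (adj? v a))

  degree : Fin n → ℕ
  degree v = ∣ N v ∣

  -- r · δ(G) ≥ (r-1)·|V(G)| + 2r, i.e. δ(G) ≥ (r-1)/r · |V(G)| + 2
  MinDegreeCond : ℕ → Set
  MinDegreeCond r = ∀ v → (r ∸ 1) * n + 2 * r ≤ r * degree v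

  IsClique : Subset n → Set
  IsClique K = ∀ {a b} → a ∈ K → b ∈ K → a ≢ b → Adj a b

  IsRClique : ℕ → Subset n → Set
  IsRClique r K = IsClique K × ∣ K ∣ ≡ r

{-# OPTIONS --safe #-}
module Submission where

-- Write r = k + 3. Summing the degree condition over v and the vertices of a set S with
-- |S| ≤ r − 1 shows that they have at least 2(|S| + 1) common neighbours. That is enough
-- room to extend cliques of N(v) greedily and to pick common neighbours outside a forbidden
-- set of at most r + 3 vertices. Two r-cliques A, B ⊆ N(v) through x are then joined by a
-- chain of such cliques through x, consecutive ones meeting in r − 2 vertices, by induction
-- on r − |A ∩ B|: if |A ∩ B| = r − 1 one intermediate clique suffices, and if
-- |A ∩ B| ≤ r − 3 two detour cliques through A ∩ B increase the overlap at every link. The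
-- chain from K ends in a clique D ∋ x of an explicit gadget D, E, F ∋ u, w built around an
-- (r − 3)-clique of common neighbours of x, u and w.

open import Defs
open import Data.Nat using (ℕ; zero; suc; _+_; _*_; _∸_; _≤_; _<_; z≤n; s≤s)
open import Data.Nat.Properties
open import Data.Nat.Tactic.RingSolver using (solve-∀)
open import Data.Fin using (Fin; zero; suc)
open import Data.Fin.Properties using (all?) renaming (_≟_ to _≟ᶠ_)
open import Data.Fin.Subset
open import Data.Fin.Subset.Properties
open import Data.Vec using ([]; _∷_; here; there; tabulate)
open import Data.Vec.Properties using (lookup∘tabulate; []=⇒lookup; lookup⇒[]=)
open import Data.Product using (Σ; _×_; _,_; proj₁; proj₂; ∃; ∃₂)
open import Data.Sum using (_⊎_; inj₁; inj₂; [_,_])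
import Data.Sum as Sum
open import Data.Empty using (⊥-elim)
open import Function using (_∘_; id)
open import Relation.Nullary using (Dec; yes; no; does)
open import Relation.Nullary.Decidable using (_×-dec_; _→-dec_; map′; dec-true)
open import Relation.Unary using (Pred; Decidable)
open import Relation.Binary.PropositionalEquality hiding ([_])
open import Relation.Binary.Construct.Closure.ReflexiveTransitive using (Star; ε; _◅_; _◅◅_)

private variable
  n : ℕ
  p q : Subset n
  x y : Fin n

∣p∩q∣+∣p∪q∣≡∣p∣+∣q∣ : (p q : Subset n) → ∣ p ∩ q ∣ + ∣ p ∪ q ∣ ≡ ∣ p ∣ + ∣ q ∣
∣p∩q∣+∣p∪q∣≡∣p∣+∣q∣ []            []            = refl
∣p∩q∣+∣p∪q∣≡∣p∣+∣q∣ (inside ∷ p)  (inside ∷ q)  =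
  cong suc (trans (+-suc _ _) (trans (cong suc (∣p∩q∣+∣p∪q∣≡∣p∣+∣q∣ p q)) (sym (+-suc _ _))))
∣p∩q∣+∣p∪q∣≡∣p∣+∣q∣ (inside ∷ p)  (outside ∷ q) = trans (+-suc _ _) (cong suc (∣p∩q∣+∣p∪q∣≡∣p∣+∣q∣ p q))
∣p∩q∣+∣p∪q∣≡∣p∣+∣q∣ (outside ∷ p) (inside ∷ q)  =
  trans (+-suc _ _) (trans (cong suc (∣p∩q∣+∣p∪q∣≡∣p∣+∣q∣ p q)) (sym (+-suc _ _)))
∣p∩q∣+∣p∪q∣≡∣p∣+∣q∣ (outside ∷ p) (outside ∷ q) = ∣p∩q∣+∣p∪q∣≡∣p∣+∣q∣ p q

∣p∪q∣≤∣p∣+∣q∣ : (p q : Subset n) → ∣ p ∪ q ∣ ≤ ∣ p ∣ + ∣ q ∣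
∣p∪q∣≤∣p∣+∣q∣ p q = subst (∣ p ∪ q ∣ ≤_) (∣p∩q∣+∣p∪q∣≡∣p∣+∣q∣ p q) (m≤n+m _ _)

∣p∣+∣q∣≤∣p∩q∣+n : (p q : Subset n) → ∣ p ∣ + ∣ q ∣ ≤ ∣ p ∩ q ∣ + n
∣p∣+∣q∣≤∣p∩q∣+n {n} p q = subst (_≤ ∣ p ∩ q ∣ + n) (∣p∩q∣+∣p∪q∣≡∣p∣+∣q∣ p q) (+-monoʳ-≤ _ (∣p∣≤n (p ∪ q)))

disjoint⇒∣p∪q∣≡∣p∣+∣q∣ : (p q : Subset n) → (∀ {x} → x ∈ p → x ∉ q) → ∣ p ∪ q ∣ ≡ ∣ p ∣ + ∣ q ∣
disjoint⇒∣p∪q∣≡∣p∣+∣q∣ {n} p q disjoint = begin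
  ∣ p ∪ q ∣                 ≡⟨ cong (_+ ∣ p ∪ q ∣) (∣⊥∣≡0 n) ⟨
  ∣ ⊥ {n} ∣ + ∣ p ∪ q ∣     ≡⟨ cong (λ s → ∣ s ∣ + ∣ p ∪ q ∣) p∩q≡⊥ ⟨
  ∣ p ∩ q ∣ + ∣ p ∪ q ∣     ≡⟨ ∣p∩q∣+∣p∪q∣≡∣p∣+∣q∣ p q ⟩
  ∣ p ∣ + ∣ q ∣             ∎
  where
  open ≡-Reasoning
  p∩q≡⊥ : p ∩ q ≡ ⊥
  p∩q≡⊥ = Empty-unique λ (x , x∈p∩q) → let x∈p , x∈q = x∈p∩q⁻ p q x∈p∩q in disjoint x∈p x∈q

∣p∣<∣q∣⇒∃∈q∖p : (p q : Subset n) → ∣ p ∣ < ∣ q ∣ → ∃ λ x → x ∈ q × x ∉ p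
∣p∣<∣q∣⇒∃∈q∖p []            []            ()
∣p∣<∣q∣⇒∃∈q∖p (outside ∷ p) (inside ∷ q)  _        = zero , here , λ ()
∣p∣<∣q∣⇒∃∈q∖p (inside ∷ p)  (inside ∷ q)  (s≤s lt) =
  let x , x∈q , x∉p = ∣p∣<∣q∣⇒∃∈q∖p p q lt in suc x , there x∈q , x∉p ∘ drop-there
∣p∣<∣q∣⇒∃∈q∖p (s ∷ p)       (outside ∷ q) lt       =
  let x , x∈q , x∉p = ∣p∣<∣q∣⇒∃∈q∖p p q (≤-trans (s≤s (∣p∣≤∣x∷p∣ s p)) lt)
  in  suc x , there x∈q , x∉p ∘ drop-there

p⊆q∧∣q∣≤∣p∣⇒p≡q : p ⊆ q → ∣ q ∣ ≤ ∣ p ∣ → p ≡ q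
p⊆q∧∣q∣≤∣p∣⇒p≡q {p = p} {q} p⊆q ∣q∣≤∣p∣ = ⊆-antisym p⊆q q⊆p
  where
  q⊆p : q ⊆ p
  q⊆p {x} x∈q with x ∈? p
  ... | yes x∈p = x∈p
  ... | no  x∉p = ⊥-elim (<⇒≱ (p⊂q⇒∣p∣<∣q∣ (p⊆q , x , x∈q , x∉p)) ∣q∣≤∣p∣)

x∈p⇒1+∣p-x∣≡∣p∣ : (p : Subset n) → x ∈ p → suc ∣ p - x ∣ ≡ ∣ p ∣
x∈p⇒1+∣p-x∣≡∣p∣ (inside ∷ p)  here        = cong (suc ∘ ∣_∣) (p─⊥≡p p)
x∈p⇒1+∣p-x∣≡∣p∣ (inside ∷ p)  (there x∈p) = cong suc (x∈p⇒1+∣p-x∣≡∣p∣ p x∈p)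
x∈p⇒1+∣p-x∣≡∣p∣ (outside ∷ p) (there x∈p) = x∈p⇒1+∣p-x∣≡∣p∣ p x∈p

x∈p∧y∉p⇒x≢y : x ∈ p → y ∉ p → x ≢ y
x∈p∧y∉p⇒x≢y x∈p y∉p refl = y∉p x∈p

x∈⁅x⁆∪p : (x : Fin n) (p : Subset n) → x ∈ ⁅ x ⁆ ∪ p
x∈⁅x⁆∪p x p = x∈p∪q⁺ (inj₁ (x∈⁅x⁆ x))

p⊆⁅x⁆∪p : (x : Fin n) (p : Subset n) → p ⊆ ⁅ x ⁆ ∪ p
p⊆⁅x⁆∪p x = q⊆p∪q ⁅ x ⁆

y∈⁅x⁆∪p⁻ : y ∈ ⁅ x ⁆ ∪ p → y ≡ x ⊎ y ∈ p
y∈⁅x⁆∪p⁻ {x = x} {p = p} y∈ = Sum.map₁ (x∈⁅y⁆⇒x≡y x) (x∈p∪q⁻ ⁅ x ⁆ p y∈)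

y∉⁅x⁆∪p : y ≢ x → y ∉ p → y ∉ ⁅ x ⁆ ∪ p
y∉⁅x⁆∪p y≢x y∉p = [ y≢x , y∉p ] ∘ y∈⁅x⁆∪p⁻

⁅x⁆∪p⊆q : x ∈ q → p ⊆ q → ⁅ x ⁆ ∪ p ⊆ q
⁅x⁆∪p⊆q {x = x} {q = q} x∈q p⊆q = [ (λ { refl → x∈q }) , p⊆q ] ∘ y∈⁅x⁆∪p⁻

⁅x⁆∪-monoʳ : p ⊆ q → ⁅ x ⁆ ∪ p ⊆ ⁅ x ⁆ ∪ q
⁅x⁆∪-monoʳ {q = q} {x = x} p⊆q = ⁅x⁆∪p⊆q (x∈⁅x⁆∪p x q) (p⊆⁅x⁆∪p x q ∘ p⊆q)

∣p∣≤m⇒∣⁅x⁆∪p∣≤1+m : ∀ {m} (x : Fin n) {p : Subset n} → ∣ p ∣ ≤ m → ∣ ⁅ x ⁆ ∪ p ∣ ≤ suc m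
∣p∣≤m⇒∣⁅x⁆∪p∣≤1+m {m = m} x {p} ∣p∣≤m = begin
  ∣ ⁅ x ⁆ ∪ p ∣      ≤⟨ ∣p∪q∣≤∣p∣+∣q∣ ⁅ x ⁆ p ⟩
  ∣ ⁅ x ⁆ ∣ + ∣ p ∣  ≡⟨ cong (_+ ∣ p ∣) (∣⁅x⁆∣≡1 x) ⟩
  suc ∣ p ∣          ≤⟨ s≤s ∣p∣≤m ⟩
  suc m              ∎
  where open ≤-Reasoning

x∉p⇒∣⁅x⁆∪p∣≡1+∣p∣ : (p : Subset n) → x ∉ p → ∣ ⁅ x ⁆ ∪ p ∣ ≡ suc ∣ p ∣
x∉p⇒∣⁅x⁆∪p∣≡1+∣p∣ {x = x} p x∉p =
  trans (disjoint⇒∣p∪q∣≡∣p∣+∣q∣ ⁅ x ⁆ p λ y∈⁅x⁆ → subst (_∉ p) (sym (x∈⁅y⁆⇒x≡y x y∈⁅x⁆)) x∉p)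
        (cong (_+ ∣ p ∣) (∣⁅x⁆∣≡1 x))

x∉p∧⁅x⁆∪p⊆q⇒∣p∣<∣q∣ : x ∉ p → ⁅ x ⁆ ∪ p ⊆ q → ∣ p ∣ < ∣ q ∣
x∉p∧⁅x⁆∪p⊆q⇒∣p∣<∣q∣ {p = p} x∉p ⊆q = subst (_≤ _) (x∉p⇒∣⁅x⁆∪p∣≡1+∣p∣ p x∉p) (p⊆q⇒∣p∣≤∣q∣ ⊆q)

[⁅x⁆∪⁅y⁆∪p]∩q≡p : ∀ {x y} {p q : Subset n} → x ∉ q → y ∉ q → p ⊆ q → (⁅ x ⁆ ∪ ⁅ y ⁆ ∪ p) ∩ q ≡ p
[⁅x⁆∪⁅y⁆∪p]∩q≡p {x = x} {y} {p} {q} x∉q y∉q p⊆q = begin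
  (⁅ x ⁆ ∪ ⁅ y ⁆ ∪ p) ∩ q   ≡⟨ [⁅z⁆∪s]∩q≡s∩q x∉q ⟩
  (⁅ y ⁆ ∪ p) ∩ q           ≡⟨ [⁅z⁆∪s]∩q≡s∩q y∉q ⟩
  p ∩ q                     ≡⟨ ⊆-antisym (p∩q⊆p p q) (λ z∈p → x∈p∩q⁺ (z∈p , p⊆q z∈p)) ⟩
  p                         ∎
  where
  open ≡-Reasoning
  [⁅z⁆∪s]∩q≡s∩q : ∀ {z s} → z ∉ q → (⁅ z ⁆ ∪ s) ∩ q ≡ s ∩ q
  [⁅z⁆∪s]∩q≡s∩q {z} {s} z∉q = begin
    (⁅ z ⁆ ∪ s) ∩ q          ≡⟨ ∩-distribʳ-∪ q ⁅ z ⁆ s ⟩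
    (⁅ z ⁆ ∩ q) ∪ (s ∩ q)    ≡⟨ cong (_∪ (s ∩ q)) ⁅z⁆∩q≡⊥ ⟩
    ⊥ ∪ (s ∩ q)              ≡⟨ ∪-identityˡ (s ∩ q) ⟩
    s ∩ q                    ∎
    where
    ⁅z⁆∩q≡⊥ : ⁅ z ⁆ ∩ q ≡ ⊥
    ⁅z⁆∩q≡⊥ = Empty-unique λ (t , t∈) → let t∈⁅z⁆ , t∈q = x∈p∩q⁻ ⁅ z ⁆ q t∈ in
      z∉q (subst (_∈ q) (x∈⁅y⁆⇒x≡y z t∈⁅z⁆) t∈q)

∣r∣<∣p∣+∣q∣⇒∃∈q∖r : (p q r : Subset n) → (∀ {x} → x ∈ q → x ∉ p) → p ⊆ r → ∣ r ∣ < ∣ p ∣ + ∣ q ∣ →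
                     ∃ λ x → x ∈ q × x ∉ r
∣r∣<∣p∣+∣q∣⇒∃∈q∖r p q r disjoint p⊆r ∣r∣<∣p∣+∣q∣ =
  let x , x∈q , x∉q∩r = ∣p∣<∣q∣⇒∃∈q∖p (q ∩ r) q ∣q∩r∣<∣q∣
  in  x , x∈q , λ x∈r → x∉q∩r (x∈p∩q⁺ (x∈q , x∈r))
  where
  ∣p∣+∣q∩r∣≤∣r∣ : ∣ p ∣ + ∣ q ∩ r ∣ ≤ ∣ r ∣
  ∣p∣+∣q∩r∣≤∣r∣ = subst (_≤ ∣ r ∣)
    (disjoint⇒∣p∪q∣≡∣p∣+∣q∣ p (q ∩ r) λ x∈p x∈q∩r → disjoint (p∩q⊆p q r x∈q∩r) x∈p)
    (p⊆q⇒∣p∣≤∣q∣ ([ p⊆r , p∩q⊆q q r ] ∘ x∈p∪q⁻ p (q ∩ r)))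
  ∣q∩r∣<∣q∣ : ∣ q ∩ r ∣ < ∣ q ∣
  ∣q∩r∣<∣q∣ = +-cancelˡ-< ∣ p ∣ _ _ (≤-<-trans ∣p∣+∣q∩r∣≤∣r∣ ∣r∣<∣p∣+∣q∣)

module _ {ℓ} {P : Pred (Fin n) ℓ} (P? : Decidable P) where

  ∈-tabulate⁺ : P x → x ∈ tabulate (λ y → does (P? y))
  ∈-tabulate⁺ {x} Px = lookup⇒[]= x _ (trans (lookup∘tabulate _ x) (dec-true (P? x) Px))

  ∈-tabulate⁻ : x ∈ tabulate (λ y → does (P? y)) → P x
  ∈-tabulate⁻ {x} x∈ with P? x | trans (sym (lookup∘tabulate (λ y → does (P? y)) x)) ([]=⇒lookup x∈)
  ... | yes Px | _  = Px
  ... | no  _  | ()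

≤3+k-split : ∀ k {s} → s ≤ 3 + k → s ≤ k ⊎ s ≡ 1 + k ⊎ s ≡ 2 + k ⊎ s ≡ 3 + k
≤3+k-split zero    {zero}                    _ = inj₁ z≤n
≤3+k-split zero    {suc zero}                _ = inj₂ (inj₁ refl)
≤3+k-split zero    {suc (suc zero)}          _ = inj₂ (inj₂ (inj₁ refl))
≤3+k-split zero    {suc (suc (suc zero))}    _ = inj₂ (inj₂ (inj₂ refl))
≤3+k-split zero    {suc (suc (suc (suc _)))} (s≤s (s≤s (s≤s ())))
≤3+k-split (suc k) {zero}                    _ = inj₁ z≤n
≤3+k-split (suc k) {suc s} (s≤s s≤3+k) =
  Sum.map s≤s (Sum.map (cong suc) (Sum.map (cong suc) (cong suc))) (≤3+k-split k s≤3+k)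

module _ {n : ℕ} (G : Graph n) where
  open Graph G renaming (sym to adj-sym)

  private variable
    m : ℕ
    P Q : Subset n
    z : Fin n

  CompleteTo : Fin n → Subset n → Set
  CompleteTo y P = ∀ {z} → z ∈ P → Adj y z

  completeTo? : ∀ y P → Dec (CompleteTo y P)
  completeTo? y P = map′ (λ f {z} → f z) (λ f z → f) (all? λ z → z ∈? P →-dec adj? y z)

  complete⇒∉ : CompleteTo y P → y ∉ P
  complete⇒∉ y~P y∈P = irrefl (y~P y∈P)

  complete-⊆ : P ⊆ Q → CompleteTo y Q → CompleteTo y P
  complete-⊆ P⊆Q y~Q = y~Q ∘ P⊆Q

  complete-⁅⁆∪ : Adj y z → CompleteTo y P → CompleteTo y (⁅ z ⁆ ∪ P)
  complete-⁅⁆∪ y~z y~P = [ (λ { refl → y~z }) , y~P ] ∘ y∈⁅x⁆∪p⁻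

  ∈N⁺ : ∀ {v} → Adj v y → y ∈ N G v
  ∈N⁺ {v = v} = ∈-tabulate⁺ (adj? v)

  ∈N⁻ : ∀ {v} → y ∈ N G v → Adj v y
  ∈N⁻ {v = v} = ∈-tabulate⁻ (adj? v)

  ⊥-clique : IsClique G ⊥
  ⊥-clique y∈⊥ = ⊥-elim (∉⊥ y∈⊥)

  clique-⊆ : P ⊆ Q → IsClique G Q → IsClique G P
  clique-⊆ P⊆Q Q-clique y∈P z∈P = Q-clique (P⊆Q y∈P) (P⊆Q z∈P)

  clique-⁅⁆∪ : IsClique G P → CompleteTo y P → IsClique G (⁅ y ⁆ ∪ P)
  clique-⁅⁆∪ P-clique y~P a∈ b∈ a≢b with y∈⁅x⁆∪p⁻ a∈ | y∈⁅x⁆∪p⁻ b∈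
  ... | inj₁ refl | inj₁ refl = ⊥-elim (a≢b refl)
  ... | inj₁ refl | inj₂ b∈P  = y~P b∈P
  ... | inj₂ a∈P  | inj₁ refl = adj-sym (y~P a∈P)
  ... | inj₂ a∈P  | inj₂ b∈P  = P-clique a∈P b∈P a≢b

  rclique-⁅⁆∪ : IsRClique G m P → CompleteTo y P → IsRClique G (suc m) (⁅ y ⁆ ∪ P)
  rclique-⁅⁆∪ {P = P} (P-clique , refl) y~P =
    clique-⁅⁆∪ P-clique y~P , x∉p⇒∣⁅x⁆∪p∣≡1+∣p∣ P (complete⇒∉ y~P)

  module CommonNeighbours {ρ : ℕ} (mindeg : MinDegreeCond G (suc ρ)) (v : Fin n) where

    Com : Subset n → Subset n
    Com S = tabulate (λ y → does (adj? v y ×-dec completeTo? y S))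

    ∈Com⁺ : ∀ {y S} → Adj v y → CompleteTo y S → y ∈ Com S
    ∈Com⁺ {S = S} v~y y~S = ∈-tabulate⁺ (λ y → adj? v y ×-dec completeTo? y S) (v~y , y~S)

    ∈Com⁻ : ∀ {y S} → y ∈ Com S → Adj v y × CompleteTo y S
    ∈Com⁻ {S = S} = ∈-tabulate⁻ (λ y → adj? v y ×-dec completeTo? y S)

    -- Each vertex misses at most n − δ vertices, so |Com S| ≥ (|S| + 1) δ − |S| n;
    -- this is that bound multiplied by suc ρ, where suc ρ · δ is bounded below by mindeg.
    ∣Com∣-bound : ∀ k S → ∣ S ∣ ≡ k → ρ * n + suc k * (2 * suc ρ) ≤ suc ρ * ∣ Com S ∣ + k * n
    ∣Com∣-bound zero S ∣S∣≡0 = begin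
      ρ * n + 1 * (2 * suc ρ)  ≡⟨ cong (ρ * n +_) (*-identityˡ (2 * suc ρ)) ⟩
      ρ * n + 2 * suc ρ        ≤⟨ mindeg v ⟩
      suc ρ * degree G v       ≤⟨ *-monoʳ-≤ (suc ρ) (p⊆q⇒∣p∣≤∣q∣ N⊆Com) ⟩
      suc ρ * ∣ Com S ∣        ≡⟨ +-identityʳ _ ⟨
      suc ρ * ∣ Com S ∣ + 0    ∎
      where
      open ≤-Reasoning
      N⊆Com : N G v ⊆ Com S
      N⊆Com y∈N = ∈Com⁺ (∈N⁻ y∈N) λ z∈S → ⊥-elim (1+n≢0 (trans (x∈p⇒1+∣p-x∣≡∣p∣ S z∈S) ∣S∣≡0))
    ∣Com∣-bound (suc k) S ∣S∣≡1+k
      with t , t∈S , _ ← ∣p∣<∣q∣⇒∃∈q∖p ⊥ S (subst₂ _<_ (sym (∣⊥∣≡0 n)) (sym ∣S∣≡1+k) (s≤s z≤n))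
      = add-vertex (∣Com∣-bound k (S - t) ∣S-t∣≡k) (mindeg t) ∣Com[S-t]∣+d≤∣Com∣+n
      where
      ∣S-t∣≡k : ∣ S - t ∣ ≡ k
      ∣S-t∣≡k = suc-injective (trans (x∈p⇒1+∣p-x∣≡∣p∣ S t∈S) ∣S∣≡1+k)
      Com[S-t]∩N⊆Com : Com (S - t) ∩ N G t ⊆ Com S
      Com[S-t]∩N⊆Com {y} y∈
        with y∈Com[S-t] , y∈N ← x∈p∩q⁻ (Com (S - t)) (N G t) y∈
        with v~y , y~S-t ← ∈Com⁻ y∈Com[S-t]
        = ∈Com⁺ v~y y~S
        where
        y~S : CompleteTo y S
        y~S {u} u∈S with u ≟ᶠ t
        ... | yes refl = adj-sym (∈N⁻ y∈N)
        ... | no  u≢t  = y~S-t (x∈p∧x≢y⇒x∈p-y u∈S u≢t)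
      ∣Com[S-t]∣+d≤∣Com∣+n : ∣ Com (S - t) ∣ + degree G t ≤ ∣ Com S ∣ + n
      ∣Com[S-t]∣+d≤∣Com∣+n =
        ≤-trans (∣p∣+∣q∣≤∣p∩q∣+n (Com (S - t)) (N G t)) (+-monoˡ-≤ n (p⊆q⇒∣p∣≤∣q∣ Com[S-t]∩N⊆Com))
      add-vertex : ∀ {c′ d c} → ρ * n + suc k * (2 * suc ρ) ≤ suc ρ * c′ + k * n → ρ * n + 2 * suc ρ ≤ suc ρ * d →
                   c′ + d ≤ c + n → ρ * n + suc (suc k) * (2 * suc ρ) ≤ suc ρ * c + suc k * n
      add-vertex {c′} {d} {c} ih deg c′+d≤c+n = +-cancelʳ-≤ (ρ * n) _ _ (begin
        ρ * n + suc (suc k) * (2 * suc ρ) + ρ * n             ≡⟨ regroup₁ ρ n k ⟩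
        (ρ * n + suc k * (2 * suc ρ)) + (ρ * n + 2 * suc ρ)   ≤⟨ +-mono-≤ ih deg ⟩
        (suc ρ * c′ + k * n) + suc ρ * d                      ≡⟨ regroup₂ ρ n k c′ d ⟩
        k * n + suc ρ * (c′ + d)                              ≤⟨ +-monoʳ-≤ (k * n) (*-monoʳ-≤ (suc ρ) c′+d≤c+n) ⟩
        k * n + suc ρ * (c + n)                               ≡⟨ regroup₃ ρ n k c ⟩
        suc ρ * c + suc k * n + ρ * n                         ∎)
        where
        open ≤-Reasoning
        regroup₁ : ∀ ρ n k → ρ * n + suc (suc k) * (2 * suc ρ) + ρ * n
                           ≡ (ρ * n + suc k * (2 * suc ρ)) + (ρ * n + 2 * suc ρ)
        regroup₁ = solve-∀
        regroup₂ : ∀ ρ n k c′ d → (suc ρ * c′ + k * n) + suc ρ * d ≡ k * n + suc ρ * (c′ + d)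
        regroup₂ = solve-∀
        regroup₃ : ∀ ρ n k c → k * n + suc ρ * (c + n) ≡ suc ρ * c + suc k * n + ρ * n
        regroup₃ = solve-∀

    2[1+∣S∣]≤∣Com∣ : ∀ S → ∣ S ∣ ≤ ρ → 2 * suc ∣ S ∣ ≤ ∣ Com S ∣
    2[1+∣S∣]≤∣Com∣ S ∣S∣≤ρ = *-cancelˡ-≤ (suc ρ) (+-cancelˡ-≤ (ρ * n) _ _ (begin
      ρ * n + suc ρ * (2 * suc s)    ≡⟨ cong (ρ * n +_) (swap (suc ρ) (suc s)) ⟩
      ρ * n + suc s * (2 * suc ρ)    ≤⟨ ∣Com∣-bound s S refl ⟩
      suc ρ * ∣ Com S ∣ + s * n      ≤⟨ +-monoʳ-≤ _ (*-monoˡ-≤ n ∣S∣≤ρ) ⟩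
      suc ρ * ∣ Com S ∣ + ρ * n      ≡⟨ +-comm _ (ρ * n) ⟩
      ρ * n + suc ρ * ∣ Com S ∣      ∎))
      where
      open ≤-Reasoning
      s : ℕ
      s = ∣ S ∣
      swap : ∀ a b → a * (2 * b) ≡ b * (2 * a)
      swap = solve-∀

    record FreshNeighbour (S F : Subset n) : Set where
      field
        vertex   : Fin n
        adj-v    : Adj v vertex
        complete : CompleteTo vertex S
        fresh    : vertex ∉ F

    -- Opaque: only the existence of the vertex matters, and letting Agda normalise the
    -- search that produces it makes type checking of its uses intractable.
    opaque
      freshNeighbour : ∀ {S F} → S ⊆ F → ∣ S ∣ ≤ ρ → ∣ F ∣ < ∣ S ∣ + 2 * suc ∣ S ∣ → FreshNeighbour S F
      freshNeighbour {S} {F} S⊆F ∣S∣≤ρ ∣F∣<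
        with y , y∈Com , y∉F ← ∣r∣<∣p∣+∣q∣⇒∃∈q∖r S (Com S) F (complete⇒∉ ∘ proj₂ ∘ ∈Com⁻) S⊆F
                                 (<-≤-trans ∣F∣< (+-monoʳ-≤ ∣ S ∣ (2[1+∣S∣]≤∣Com∣ S ∣S∣≤ρ)))
        = record { vertex = y ; adj-v = proj₁ (∈Com⁻ y∈Com) ; complete = proj₂ (∈Com⁻ y∈Com) ; fresh = y∉F }

    extend : ∀ d {W T} → IsClique G T → T ⊆ Com W → ∣ W ∣ + ∣ T ∣ + d ≤ suc ρ →
             ∃ λ T′ → T ⊆ T′ × IsClique G T′ × T′ ⊆ Com W × ∣ T′ ∣ ≡ ∣ T ∣ + d
    extend zero    {T = T} T-clique T⊆Com _ = T , id , T-clique , T⊆Com , sym (+-identityʳ ∣ T ∣)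
    extend (suc d) {W} {T} T-clique T⊆Com bound =
      let T′ , ⁅t⁆∪T⊆T′ , T′-clique , T′⊆Com , ∣T′∣≡ = extend d ⁅t⁆∪T-clique ⁅t⁆∪T⊆Com bound′
      in  T′ , ⁅t⁆∪T⊆T′ ∘ p⊆⁅x⁆∪p t T , T′-clique , T′⊆Com ,
          trans ∣T′∣≡ (trans (cong (_+ d) ∣⁅t⁆∪T∣≡) (sym (+-suc ∣ T ∣ d)))
      where
      open ≤-Reasoning
      ∣W∪T∣≤ρ : ∣ W ∪ T ∣ ≤ ρ
      ∣W∪T∣≤ρ = ≤-pred (begin
        suc ∣ W ∪ T ∣            ≤⟨ s≤s (∣p∪q∣≤∣p∣+∣q∣ W T) ⟩
        suc (∣ W ∣ + ∣ T ∣)      ≤⟨ s≤s (m≤m+n _ d) ⟩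
        suc (∣ W ∣ + ∣ T ∣ + d)  ≡⟨ +-suc _ d ⟨
        ∣ W ∣ + ∣ T ∣ + suc d    ≤⟨ bound ⟩
        suc ρ                    ∎)
      open FreshNeighbour (freshNeighbour {W ∪ T} {W ∪ T} id ∣W∪T∣≤ρ (m<m+n _ (s≤s z≤n)))
        renaming (vertex to t; adj-v to v~t; complete to t~W∪T; fresh to t∉W∪T)
      ⁅t⁆∪T-clique : IsClique G (⁅ t ⁆ ∪ T)
      ⁅t⁆∪T-clique = clique-⁅⁆∪ T-clique (complete-⊆ (q⊆p∪q W T) t~W∪T)
      ⁅t⁆∪T⊆Com : ⁅ t ⁆ ∪ T ⊆ Com W
      ⁅t⁆∪T⊆Com = ⁅x⁆∪p⊆q (∈Com⁺ v~t (complete-⊆ (p⊆p∪q T) t~W∪T)) T⊆Com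
      ∣⁅t⁆∪T∣≡ : ∣ ⁅ t ⁆ ∪ T ∣ ≡ suc ∣ T ∣
      ∣⁅t⁆∪T∣≡ = x∉p⇒∣⁅x⁆∪p∣≡1+∣p∣ T (t∉W∪T ∘ q⊆p∪q W T)
      bound′ : ∣ W ∣ + ∣ ⁅ t ⁆ ∪ T ∣ + d ≤ suc ρ
      bound′ = begin
        ∣ W ∣ + ∣ ⁅ t ⁆ ∪ T ∣ + d  ≡⟨ cong (λ s → ∣ W ∣ + s + d) ∣⁅t⁆∪T∣≡ ⟩
        ∣ W ∣ + suc ∣ T ∣ + d      ≡⟨ cong (_+ d) (+-suc ∣ W ∣ ∣ T ∣) ⟩
        suc (∣ W ∣ + ∣ T ∣ + d)    ≡⟨ +-suc _ d ⟨
        ∣ W ∣ + ∣ T ∣ + suc d      ≤⟨ bound ⟩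
        suc ρ                      ∎

  module Chains {k : ℕ} (mindeg : MinDegreeCond G (3 + k)) (v x : Fin n) where
    open CommonNeighbours mindeg v

    r : ℕ
    r = 3 + k

    ≤k⇒<r : ∀ {s} → s ≤ k → s < r
    ≤k⇒<r s≤k = ≤-trans (s≤s s≤k) (m≤n+m (suc k) 2)

    Good : Subset n → Set
    Good A = IsRClique G r A × A ⊆ N G v

    goodExtension : ∀ {T} → IsClique G T → T ⊆ N G v → ∣ T ∣ ≤ r → ∃ λ C → T ⊆ C × Good C
    goodExtension {T} T-clique T⊆N ∣T∣≤r =
      let C , T⊆C , C-clique , C⊆Com , ∣C∣≡ = extend (r ∸ ∣ T ∣) T-clique T⊆Com⊥ bound
      in  C , T⊆C , (C-clique , trans ∣C∣≡ (m+[n∸m]≡n ∣T∣≤r)) , ∈N⁺ ∘ proj₁ ∘ ∈Com⁻ ∘ C⊆Com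
      where
      T⊆Com⊥ : T ⊆ Com ⊥
      T⊆Com⊥ y∈T = ∈Com⁺ (∈N⁻ (T⊆N y∈T)) (⊥-elim ∘ ∉⊥)
      bound : ∣ ⊥ {n} ∣ + ∣ T ∣ + (r ∸ ∣ T ∣) ≤ r
      bound = ≤-reflexive (trans (cong (λ s → s + ∣ T ∣ + (r ∸ ∣ T ∣)) (∣⊥∣≡0 n)) (m+[n∸m]≡n ∣T∣≤r))

    freshNeighbour-r∸1 : ∀ {S F} → S ⊆ F → ∣ S ∣ ≡ r ∸ 1 → ∣ F ∣ ≤ 3 + r → FreshNeighbour S F
    freshNeighbour-r∸1 {S} {F} S⊆F ∣S∣≡ ∣F∣≤ = freshNeighbour S⊆F (≤-reflexive ∣S∣≡) (begin-strict
      ∣ F ∣                      ≤⟨ ∣F∣≤ ⟩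
      6 + k                      <⟨ m≤m+n (7 + k) (1 + 2 * k) ⟩
      7 + k + (1 + 2 * k)        ≡⟨ regroup k ⟩
      (2 + k) + 2 * suc (2 + k)  ≡⟨ cong (λ s → s + 2 * suc s) ∣S∣≡ ⟨
      ∣ S ∣ + 2 * suc ∣ S ∣      ∎)
      where
      open ≤-Reasoning
      regroup : ∀ k → 7 + k + (1 + 2 * k) ≡ (2 + k) + 2 * (3 + k)
      regroup = solve-∀

    -- The target of a step is constrained only by the next step, so the clique reached
    -- by the last step of a walk need not contain x.
    Step : Subset n → Subset n → Set
    Step A B = Good A × x ∈ A × ∣ A ∩ B ∣ ≡ r ∸ 2

    Chain : Subset n → Subset n → Set
    Chain = Star Step

    -- Replace a vertex i ≠ x of A ∩ B by two new common neighbours outside A ∪ B.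
    bridge : ∀ {A B} → Good A → Good B → x ∈ A → x ∈ B → ∣ A ∩ B ∣ ≡ r ∸ 1 → Chain A B
    bridge {A} {B} A-good@((A-clique , ∣A∣≡r) , A⊆N) ((_ , ∣B∣≡r) , _) x∈A x∈B ∣A∩B∣≡
      with i , i∈A∩B , i∉⁅x⁆ ← ∣p∣<∣q∣⇒∃∈q∖p ⁅ x ⁆ (A ∩ B)
                                 (subst₂ _<_ (sym (∣⁅x⁆∣≡1 x)) (sym ∣A∩B∣≡) (s≤s (s≤s z≤n)))
      = A→C ◅ C→B ◅ ε
      where
      Z : Subset n
      Z = A ∩ B - i
      ∣Z∣≡ : ∣ Z ∣ ≡ r ∸ 2
      ∣Z∣≡ = suc-injective (trans (x∈p⇒1+∣p-x∣≡∣p∣ (A ∩ B) i∈A∩B) ∣A∩B∣≡)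
      Z⊆A∩B : Z ⊆ A ∩ B
      Z⊆A∩B = p─q⊆p (A ∩ B) ⁅ i ⁆
      Z⊆A : Z ⊆ A
      Z⊆A = p∩q⊆p A B ∘ Z⊆A∩B
      Z⊆B : Z ⊆ B
      Z⊆B = p∩q⊆q A B ∘ Z⊆A∩B
      x∈Z : x ∈ Z
      x∈Z = x∈p∧x≢y⇒x∈p-y (x∈p∩q⁺ (x∈A , x∈B)) (≢-sym (x∉⁅y⁆⇒x≢y i∉⁅x⁆))
      ∣A∪B∣≡ : ∣ A ∪ B ∣ ≡ suc r
      ∣A∪B∣≡ = +-cancelˡ-≡ (r ∸ 1) _ _ (begin
        (r ∸ 1) + ∣ A ∪ B ∣      ≡⟨ cong (_+ ∣ A ∪ B ∣) ∣A∩B∣≡ ⟨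
        ∣ A ∩ B ∣ + ∣ A ∪ B ∣    ≡⟨ ∣p∩q∣+∣p∪q∣≡∣p∣+∣q∣ A B ⟩
        ∣ A ∣ + ∣ B ∣            ≡⟨ cong₂ _+_ ∣A∣≡r ∣B∣≡r ⟩
        r + r                    ≡⟨ +-suc (r ∸ 1) r ⟨
        (r ∸ 1) + suc r          ∎)
        where open ≡-Reasoning
      open FreshNeighbour (freshNeighbour-r∸1 {A ∩ B} {A ∪ B} (p⊆p∪q B ∘ p∩q⊆p A B) ∣A∩B∣≡
                                               (≤-trans (≤-reflexive ∣A∪B∣≡) (m≤n+m (suc r) 2)))
        renaming (vertex to a; adj-v to v~a; complete to a~A∩B; fresh to a∉A∪B)
      open FreshNeighbour (freshNeighbour-r∸1 {⁅ a ⁆ ∪ Z} {⁅ a ⁆ ∪ (A ∪ B)} (⁅x⁆∪-monoʳ (p⊆p∪q B ∘ Z⊆A))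
                             (trans (x∉p⇒∣⁅x⁆∪p∣≡1+∣p∣ Z (a∉A∪B ∘ p⊆p∪q B ∘ Z⊆A)) (cong suc ∣Z∣≡))
                             (∣p∣≤m⇒∣⁅x⁆∪p∣≤1+m a (≤-trans (≤-reflexive ∣A∪B∣≡) (m≤n+m (suc r) 1))))
        renaming (vertex to b; adj-v to v~b; complete to b~⁅a⁆∪Z; fresh to b∉⁅a⁆∪A∪B)
      b∉A∪B : b ∉ A ∪ B
      b∉A∪B = b∉⁅a⁆∪A∪B ∘ p⊆⁅x⁆∪p a (A ∪ B)
      C : Subset n
      C = ⁅ b ⁆ ∪ ⁅ a ⁆ ∪ Z
      C-good : Good C
      C-good = rclique-⁅⁆∪ (rclique-⁅⁆∪ (clique-⊆ Z⊆A A-clique , ∣Z∣≡) (complete-⊆ Z⊆A∩B a~A∩B)) b~⁅a⁆∪Z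
             , ⁅x⁆∪p⊆q (∈N⁺ v~b) (⁅x⁆∪p⊆q (∈N⁺ v~a) (A⊆N ∘ Z⊆A))
      x∈C : x ∈ C
      x∈C = p⊆⁅x⁆∪p b _ (p⊆⁅x⁆∪p a Z x∈Z)
      ∣A∩C∣≡ : ∣ A ∩ C ∣ ≡ r ∸ 2
      ∣A∩C∣≡ = trans (cong ∣_∣ (trans (∩-comm A C)
                 ([⁅x⁆∪⁅y⁆∪p]∩q≡p (b∉A∪B ∘ p⊆p∪q B) (a∉A∪B ∘ p⊆p∪q B) Z⊆A))) ∣Z∣≡
      ∣C∩B∣≡ : ∣ C ∩ B ∣ ≡ r ∸ 2
      ∣C∩B∣≡ = trans (cong ∣_∣ ([⁅x⁆∪⁅y⁆∪p]∩q≡p (b∉A∪B ∘ q⊆p∪q A B) (a∉A∪B ∘ q⊆p∪q A B) Z⊆B)) ∣Z∣≡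
      A→C : Step A C
      A→C = A-good , x∈A , ∣A∩C∣≡
      C→B : Step C B
      C→B = C-good , x∈C , ∣C∩B∣≡

    -- Take a ∈ A ∖ B, b ∈ B ∖ A and a common neighbour c of (A ∩ B) + a + b, and extend
    -- (A ∩ B) + a + c to C₁ and (A ∩ B) + b + c to C₂.
    detour : ∀ {A B} → Good A → Good B → x ∈ A → x ∈ B → ∣ A ∩ B ∣ ≤ k →
             ∃₂ λ C₁ C₂ → (Good C₁ × x ∈ C₁) × (Good C₂ × x ∈ C₂) ×
               ∣ A ∩ B ∣ < ∣ A ∩ C₁ ∣ × ∣ A ∩ B ∣ < ∣ C₁ ∩ C₂ ∣ × ∣ A ∩ B ∣ < ∣ C₂ ∩ B ∣
    detour {A} {B} ((A-clique , ∣A∣≡r) , A⊆N) ((B-clique , ∣B∣≡r) , B⊆N) x∈A x∈B ∣A∩B∣≤k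
      with a , a∈A , a∉Y ← ∣p∣<∣q∣⇒∃∈q∖p (A ∩ B) A (subst (∣ A ∩ B ∣ <_) (sym ∣A∣≡r) (≤k⇒<r ∣A∩B∣≤k))
      with b , b∈B , b∉Y ← ∣p∣<∣q∣⇒∃∈q∖p (A ∩ B) B (subst (∣ A ∩ B ∣ <_) (sym ∣B∣≡r) (≤k⇒<r ∣A∩B∣≤k))
      = let C₁ , T₁⊆C₁ , C₁-good = goodExtension T₁-clique T₁⊆N (m≤n⇒m≤1+n (∣⁅y⁆∪⁅z⁆∪Y∣≤ c a))
            C₂ , T₂⊆C₂ , C₂-good = goodExtension T₂-clique T₂⊆N (m≤n⇒m≤1+n (∣⁅y⁆∪⁅z⁆∪Y∣≤ c b))
        in  C₁ , C₂ , (C₁-good , T₁⊆C₁ (x∈⁅y⁆∪⁅z⁆∪Y c a)) , (C₂-good , T₂⊆C₂ (x∈⁅y⁆∪⁅z⁆∪Y c b))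
          , grow a∉Y ⁅a⁆∪Y⊆A (T₁⊆C₁ ∘ p⊆⁅x⁆∪p c _)
          , grow c∉Y (T₁⊆C₁ ∘ ⁅x⁆∪-monoʳ (p⊆⁅x⁆∪p a Y)) (T₂⊆C₂ ∘ ⁅x⁆∪-monoʳ (p⊆⁅x⁆∪p b Y))
          , grow b∉Y (T₂⊆C₂ ∘ p⊆⁅x⁆∪p c _) ⁅b⁆∪Y⊆B
      where
      Y : Subset n
      Y = A ∩ B
      ∣⁅y⁆∪⁅z⁆∪Y∣≤ : ∀ y z → ∣ ⁅ y ⁆ ∪ ⁅ z ⁆ ∪ Y ∣ ≤ 2 + k
      ∣⁅y⁆∪⁅z⁆∪Y∣≤ y z = ∣p∣≤m⇒∣⁅x⁆∪p∣≤1+m y (∣p∣≤m⇒∣⁅x⁆∪p∣≤1+m z ∣A∩B∣≤k)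
      x∈⁅y⁆∪⁅z⁆∪Y : ∀ y z → x ∈ ⁅ y ⁆ ∪ ⁅ z ⁆ ∪ Y
      x∈⁅y⁆∪⁅z⁆∪Y y z = p⊆⁅x⁆∪p y _ (p⊆⁅x⁆∪p z Y (x∈p∩q⁺ (x∈A , x∈B)))
      ⁅a⁆∪Y⊆A : ⁅ a ⁆ ∪ Y ⊆ A
      ⁅a⁆∪Y⊆A = ⁅x⁆∪p⊆q a∈A (p∩q⊆p A B)
      ⁅b⁆∪Y⊆B : ⁅ b ⁆ ∪ Y ⊆ B
      ⁅b⁆∪Y⊆B = ⁅x⁆∪p⊆q b∈B (p∩q⊆q A B)
      open FreshNeighbour (freshNeighbour {⁅ a ⁆ ∪ ⁅ b ⁆ ∪ Y} id (∣⁅y⁆∪⁅z⁆∪Y∣≤ a b) (m<m+n _ (s≤s z≤n)))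
        renaming (vertex to c; adj-v to v~c; complete to c~⁅a⁆∪⁅b⁆∪Y; fresh to c∉⁅a⁆∪⁅b⁆∪Y)
      c∉Y : c ∉ Y
      c∉Y = c∉⁅a⁆∪⁅b⁆∪Y ∘ p⊆⁅x⁆∪p a _ ∘ p⊆⁅x⁆∪p b Y
      T₁-clique : IsClique G (⁅ c ⁆ ∪ ⁅ a ⁆ ∪ Y)
      T₁-clique = clique-⁅⁆∪ (clique-⊆ ⁅a⁆∪Y⊆A A-clique) (complete-⊆ (⁅x⁆∪-monoʳ (p⊆⁅x⁆∪p b Y)) c~⁅a⁆∪⁅b⁆∪Y)
      T₂-clique : IsClique G (⁅ c ⁆ ∪ ⁅ b ⁆ ∪ Y)
      T₂-clique = clique-⁅⁆∪ (clique-⊆ ⁅b⁆∪Y⊆B B-clique) (complete-⊆ (p⊆⁅x⁆∪p a _) c~⁅a⁆∪⁅b⁆∪Y)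
      T₁⊆N : ⁅ c ⁆ ∪ ⁅ a ⁆ ∪ Y ⊆ N G v
      T₁⊆N = ⁅x⁆∪p⊆q (∈N⁺ v~c) (A⊆N ∘ ⁅a⁆∪Y⊆A)
      T₂⊆N : ⁅ c ⁆ ∪ ⁅ b ⁆ ∪ Y ⊆ N G v
      T₂⊆N = ⁅x⁆∪p⊆q (∈N⁺ v~c) (B⊆N ∘ ⁅b⁆∪Y⊆B)
      grow : ∀ {y P Q} → y ∉ Y → ⁅ y ⁆ ∪ Y ⊆ P → ⁅ y ⁆ ∪ Y ⊆ Q → ∣ Y ∣ < ∣ P ∩ Q ∣
      grow y∉Y ⊆P ⊆Q = x∉p∧⁅x⁆∪p⊆q⇒∣p∣<∣q∣ y∉Y λ z∈ → x∈p∩q⁺ (⊆P z∈ , ⊆Q z∈)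

    chain : ∀ fuel {A B} → Good A → Good B → x ∈ A → x ∈ B → r ≤ ∣ A ∩ B ∣ + fuel → Chain A B
    chain fuel {A} {B} A-good B-good x∈A x∈B bound
      with ≤3+k-split k (≤-trans (∣p∩q∣≤∣p∣ A B) (≤-reflexive (proj₂ (proj₁ A-good))))
    chain zero    A-good B-good x∈A x∈B bound | inj₁ ∣A∩B∣≤k =
      ⊥-elim (<⇒≱ (≤k⇒<r ∣A∩B∣≤k) (subst (r ≤_) (+-identityʳ _) bound))
    chain (suc f) {A} {B} A-good B-good x∈A x∈B bound | inj₁ ∣A∩B∣≤k =
      let C₁ , C₂ , (C₁-good , x∈C₁) , (C₂-good , x∈C₂) , A∩C₁-larger , C₁∩C₂-larger , C₂∩B-larger =
            detour A-good B-good x∈A x∈B ∣A∩B∣≤k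
      in  chain f A-good  C₁-good x∈A  x∈C₁ (closer A∩C₁-larger)
       ◅◅ chain f C₁-good C₂-good x∈C₁ x∈C₂ (closer C₁∩C₂-larger)
       ◅◅ chain f C₂-good B-good  x∈C₂ x∈B  (closer C₂∩B-larger)
      where
      closer : ∀ {s} → ∣ A ∩ B ∣ < s → r ≤ s + f
      closer ∣A∩B∣<s = ≤-trans bound (≤-trans (≤-reflexive (+-suc _ f)) (+-monoˡ-≤ f ∣A∩B∣<s))
    chain _ A-good _ x∈A _ _ | inj₂ (inj₁ ∣A∩B∣≡) = (A-good , x∈A , ∣A∩B∣≡) ◅ ε
    chain _ A-good B-good x∈A x∈B _ | inj₂ (inj₂ (inj₁ ∣A∩B∣≡)) = bridge A-good B-good x∈A x∈B ∣A∩B∣≡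
    chain _ {A} {B} ((_ , ∣A∣≡r) , _) ((_ , ∣B∣≡r) , _) _ _ _ | inj₂ (inj₂ (inj₂ ∣A∩B∣≡r)) =
      subst (Chain A) (trans (sym (A∩B≡ (p∩q⊆p A B) ∣A∣≡r)) (A∩B≡ (p∩q⊆q A B) ∣B∣≡r)) ε
      where
      A∩B≡ : ∀ {D} → A ∩ B ⊆ D → ∣ D ∣ ≡ r → A ∩ B ≡ D
      A∩B≡ A∩B⊆D ∣D∣≡r = p⊆q∧∣q∣≤∣p∣⇒p≡q A∩B⊆D (≤-reflexive (trans ∣D∣≡r (sym ∣A∩B∣≡r)))

    module _ (u w : Fin n) where

      Walk : Subset n → Set
      Walk A = Σ ℕ λ m → Σ (ℕ → Subset n) λ Ks →
        1 ≤ m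
        × (∀ i → i < m → Good (Ks i))
        × Ks 0 ≡ A
        × u ∈ Ks (m ∸ 1) × w ∈ Ks (m ∸ 1)
        × (∀ i → i + 2 < m → x ∈ Ks i)
        × (∀ i → i + 1 < m → ∣ Ks i ∩ Ks (i + 1) ∣ ≡ r ∸ 2)

      finalPair : ∀ {E F} → Good E → Good F → ∣ E ∩ F ∣ ≡ r ∸ 2 → u ∈ F → w ∈ F → Walk E
      finalPair {E} {F} E-good F-good ∣E∩F∣≡ u∈F w∈F = 2 , Ks , s≤s z≤n , good , refl , u∈F , w∈F , x∈ , meet
        where
        Ks : ℕ → Subset n
        Ks zero    = E
        Ks (suc _) = F
        good : ∀ i → i < 2 → Good (Ks i)
        good zero    _ = E-good
        good (suc _) _ = F-good
        x∈ : ∀ i → i + 2 < 2 → x ∈ Ks i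
        x∈ i i+2<2 = ⊥-elim (<⇒≱ i+2<2 (m≤n+m 2 i))
        meet : ∀ i → i + 1 < 2 → ∣ Ks i ∩ Ks (i + 1) ∣ ≡ r ∸ 2
        meet zero    _     = ∣E∩F∣≡
        meet (suc i) i+2<2 = ⊥-elim (<⇒≱ i+2<2 (+-monoˡ-≤ 1 (s≤s (z≤n {i}))))

      prepend : ∀ {A B} → Step A B → Walk B → Walk A
      prepend {A} {B} (A-good , x∈A , ∣A∩B∣≡) (suc m , Ks , s≤s z≤n , good , Ks0≡B , u∈ , w∈ , x∈ , meet) =
        suc (suc m) , Ks′ , s≤s z≤n , good′ , refl , u∈ , w∈ , x∈′ , meet′
        where
        Ks′ : ℕ → Subset n
        Ks′ zero    = A
        Ks′ (suc i) = Ks i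
        good′ : ∀ i → i < suc (suc m) → Good (Ks′ i)
        good′ zero    _        = A-good
        good′ (suc i) (s≤s i<) = good i i<
        x∈′ : ∀ i → i + 2 < suc (suc m) → x ∈ Ks′ i
        x∈′ zero    _        = x∈A
        x∈′ (suc i) (s≤s i<) = x∈ i i<
        meet′ : ∀ i → i + 1 < suc (suc m) → ∣ Ks′ i ∩ Ks′ (i + 1) ∣ ≡ r ∸ 2
        meet′ zero    _        = subst (λ K → ∣ A ∩ K ∣ ≡ r ∸ 2) (sym Ks0≡B) ∣A∩B∣≡
        meet′ (suc i) (s≤s i<) = meet i i<

      walkAlong : ∀ {A B} → Chain A B → Walk B → Walk A
      walkAlong ε        walk = walk
      walkAlong (s ◅ ss) walk = prepend s (walkAlong ss walk)

      -- Around an (r − 3)-clique T of common neighbours of x, u and w, pick in turn common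
      -- neighbours a of T + u + w, b of T + a + x, c of T + b + a and d of T + x + b, each
      -- outside all vertices named so far. Then F = T + a + u + w, E = T + c + b + a and
      -- D = T + d + x + b are r-cliques with E ∩ F = T + a and D ∩ E = T + b.
      module EdgeGadget (u~w : Adj u w) (v~u : Adj v u) (v~w : Adj v w) (v~x : Adj v x)
                        {T : Subset n} (T-rclique : IsRClique G k T)
                        (T⊆Com : T ⊆ Com (⁅ x ⁆ ∪ ⁅ u ⁆ ∪ ⁅ w ⁆)) where

        W~T : ∀ {y} → y ∈ ⁅ x ⁆ ∪ ⁅ u ⁆ ∪ ⁅ w ⁆ → CompleteTo y T
        W~T y∈W t∈T = adj-sym (proj₂ (∈Com⁻ (T⊆Com t∈T)) y∈W)

        x~T : CompleteTo x T
        x~T = W~T (x∈⁅x⁆∪p x _)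
        u~T : CompleteTo u T
        u~T = W~T (p⊆⁅x⁆∪p x _ (x∈⁅x⁆∪p u _))
        w~T : CompleteTo w T
        w~T = W~T (p⊆⁅x⁆∪p x _ (p⊆⁅x⁆∪p u _ (x∈⁅x⁆ w)))

        T⊆N : T ⊆ N G v
        T⊆N = ∈N⁺ ∘ proj₁ ∘ ∈Com⁻ ∘ T⊆Com

        Φ₀ : Subset n
        Φ₀ = ⁅ x ⁆ ∪ ⁅ u ⁆ ∪ ⁅ w ⁆ ∪ T

        x∈Φ₀ : x ∈ Φ₀
        x∈Φ₀ = x∈⁅x⁆∪p x _

        T⊆Φ₀ : T ⊆ Φ₀
        T⊆Φ₀ = p⊆⁅x⁆∪p x _ ∘ p⊆⁅x⁆∪p u _ ∘ p⊆⁅x⁆∪p w T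

        ∣Φ₀∣≤ : ∣ Φ₀ ∣ ≤ 3 + k
        ∣Φ₀∣≤ = ∣p∣≤m⇒∣⁅x⁆∪p∣≤1+m x (∣p∣≤m⇒∣⁅x⁆∪p∣≤1+m u (∣p∣≤m⇒∣⁅x⁆∪p∣≤1+m w (≤-reflexive (proj₂ T-rclique))))

        ⁅u⁆∪⁅w⁆∪T-rclique : IsRClique G (2 + k) (⁅ u ⁆ ∪ ⁅ w ⁆ ∪ T)
        ⁅u⁆∪⁅w⁆∪T-rclique = rclique-⁅⁆∪ (rclique-⁅⁆∪ T-rclique w~T) (complete-⁅⁆∪ u~w u~T)

        open FreshNeighbour (freshNeighbour-r∸1 {⁅ u ⁆ ∪ ⁅ w ⁆ ∪ T} {Φ₀} (p⊆⁅x⁆∪p x _)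
                               (proj₂ ⁅u⁆∪⁅w⁆∪T-rclique) (m≤n⇒m≤o+n 3 ∣Φ₀∣≤))
          renaming (vertex to a; adj-v to v~a; complete to a~⁅u⁆∪⁅w⁆∪T; fresh to a∉Φ₀)

        a~T : CompleteTo a T
        a~T = complete-⊆ (p⊆⁅x⁆∪p u _ ∘ p⊆⁅x⁆∪p w T) a~⁅u⁆∪⁅w⁆∪T

        Φ₁ : Subset n
        Φ₁ = ⁅ a ⁆ ∪ Φ₀

        ∣⁅a⁆∪⁅x⁆∪T∣≡ : ∣ ⁅ a ⁆ ∪ ⁅ x ⁆ ∪ T ∣ ≡ 2 + k
        ∣⁅a⁆∪⁅x⁆∪T∣≡ = trans (x∉p⇒∣⁅x⁆∪p∣≡1+∣p∣ (⁅ x ⁆ ∪ T) (a∉Φ₀ ∘ ⁅x⁆∪-monoʳ (p⊆⁅x⁆∪p u _ ∘ p⊆⁅x⁆∪p w T)))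
                              (cong suc (proj₂ (rclique-⁅⁆∪ T-rclique x~T)))

        open FreshNeighbour (freshNeighbour-r∸1 {⁅ a ⁆ ∪ ⁅ x ⁆ ∪ T} {Φ₁}
                               (⁅x⁆∪-monoʳ (⁅x⁆∪-monoʳ (p⊆⁅x⁆∪p u _ ∘ p⊆⁅x⁆∪p w T)))
                               ∣⁅a⁆∪⁅x⁆∪T∣≡ (m≤n⇒m≤o+n 2 (∣p∣≤m⇒∣⁅x⁆∪p∣≤1+m a ∣Φ₀∣≤)))
          renaming (vertex to b; adj-v to v~b; complete to b~⁅a⁆∪⁅x⁆∪T; fresh to b∉Φ₁)

        b~T : CompleteTo b T
        b~T = complete-⊆ (p⊆⁅x⁆∪p a _ ∘ p⊆⁅x⁆∪p x T) b~⁅a⁆∪⁅x⁆∪T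

        Φ₂ : Subset n
        Φ₂ = ⁅ b ⁆ ∪ Φ₁

        ⁅b⁆∪⁅a⁆∪T-rclique : IsRClique G (2 + k) (⁅ b ⁆ ∪ ⁅ a ⁆ ∪ T)
        ⁅b⁆∪⁅a⁆∪T-rclique = rclique-⁅⁆∪ (rclique-⁅⁆∪ T-rclique a~T) (complete-⁅⁆∪ (b~⁅a⁆∪⁅x⁆∪T (x∈⁅x⁆∪p a _)) b~T)

        open FreshNeighbour (freshNeighbour-r∸1 {⁅ b ⁆ ∪ ⁅ a ⁆ ∪ T} {Φ₂} (⁅x⁆∪-monoʳ (⁅x⁆∪-monoʳ T⊆Φ₀))
                               (proj₂ ⁅b⁆∪⁅a⁆∪T-rclique)
                               (m≤n⇒m≤o+n 1 (∣p∣≤m⇒∣⁅x⁆∪p∣≤1+m b (∣p∣≤m⇒∣⁅x⁆∪p∣≤1+m a ∣Φ₀∣≤))))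
          renaming (vertex to c; adj-v to v~c; complete to c~⁅b⁆∪⁅a⁆∪T; fresh to c∉Φ₂)

        Φ₃ : Subset n
        Φ₃ = ⁅ c ⁆ ∪ Φ₂

        ⁅x⁆∪⁅b⁆∪T-rclique : IsRClique G (2 + k) (⁅ x ⁆ ∪ ⁅ b ⁆ ∪ T)
        ⁅x⁆∪⁅b⁆∪T-rclique = rclique-⁅⁆∪ (rclique-⁅⁆∪ T-rclique b~T)
                              (complete-⁅⁆∪ (adj-sym (b~⁅a⁆∪⁅x⁆∪T (p⊆⁅x⁆∪p a _ (x∈⁅x⁆∪p x T)))) x~T)

        ⁅x⁆∪⁅b⁆∪T⊆Φ₃ : ⁅ x ⁆ ∪ ⁅ b ⁆ ∪ T ⊆ Φ₃
        ⁅x⁆∪⁅b⁆∪T⊆Φ₃ = ⁅x⁆∪p⊆q (p⊆⁅x⁆∪p c _ (p⊆⁅x⁆∪p b _ (p⊆⁅x⁆∪p a _ x∈Φ₀)))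
                         (⁅x⁆∪p⊆q (p⊆⁅x⁆∪p c _ (x∈⁅x⁆∪p b _)) (p⊆⁅x⁆∪p c _ ∘ p⊆⁅x⁆∪p b _ ∘ p⊆⁅x⁆∪p a _ ∘ T⊆Φ₀))

        open FreshNeighbour (freshNeighbour-r∸1 {⁅ x ⁆ ∪ ⁅ b ⁆ ∪ T} {Φ₃} ⁅x⁆∪⁅b⁆∪T⊆Φ₃ (proj₂ ⁅x⁆∪⁅b⁆∪T-rclique)
                               (∣p∣≤m⇒∣⁅x⁆∪p∣≤1+m c (∣p∣≤m⇒∣⁅x⁆∪p∣≤1+m b (∣p∣≤m⇒∣⁅x⁆∪p∣≤1+m a ∣Φ₀∣≤))))
          renaming (vertex to d; adj-v to v~d; complete to d~⁅x⁆∪⁅b⁆∪T; fresh to d∉Φ₃)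

        D E F : Subset n
        D = ⁅ d ⁆ ∪ ⁅ x ⁆ ∪ ⁅ b ⁆ ∪ T
        E = ⁅ c ⁆ ∪ ⁅ b ⁆ ∪ ⁅ a ⁆ ∪ T
        F = ⁅ a ⁆ ∪ ⁅ u ⁆ ∪ ⁅ w ⁆ ∪ T

        D-good : Good D
        D-good = rclique-⁅⁆∪ ⁅x⁆∪⁅b⁆∪T-rclique d~⁅x⁆∪⁅b⁆∪T
               , ⁅x⁆∪p⊆q (∈N⁺ v~d) (⁅x⁆∪p⊆q (∈N⁺ v~x) (⁅x⁆∪p⊆q (∈N⁺ v~b) T⊆N))
        E-good : Good E
        E-good = rclique-⁅⁆∪ ⁅b⁆∪⁅a⁆∪T-rclique c~⁅b⁆∪⁅a⁆∪T
               , ⁅x⁆∪p⊆q (∈N⁺ v~c) (⁅x⁆∪p⊆q (∈N⁺ v~b) (⁅x⁆∪p⊆q (∈N⁺ v~a) T⊆N))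
        F-good : Good F
        F-good = rclique-⁅⁆∪ ⁅u⁆∪⁅w⁆∪T-rclique a~⁅u⁆∪⁅w⁆∪T
               , ⁅x⁆∪p⊆q (∈N⁺ v~a) (⁅x⁆∪p⊆q (∈N⁺ v~u) (⁅x⁆∪p⊆q (∈N⁺ v~w) T⊆N))

        ∣D∩E∣≡ : ∣ D ∩ E ∣ ≡ r ∸ 2
        ∣D∩E∣≡ = trans (cong ∣_∣ ([⁅x⁆∪⁅y⁆∪p]∩q≡p (d∉Φ₃ ∘ E⊆Φ₃) x∉E (p⊆⁅x⁆∪p c _ ∘ ⁅x⁆∪-monoʳ (p⊆⁅x⁆∪p a T))))
                       (proj₂ (rclique-⁅⁆∪ T-rclique b~T))
          where
          E⊆Φ₃ : E ⊆ Φ₃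
          E⊆Φ₃ = ⁅x⁆∪-monoʳ (⁅x⁆∪-monoʳ (⁅x⁆∪-monoʳ T⊆Φ₀))
          x∉E : x ∉ E
          x∉E = y∉⁅x⁆∪p (x∈p∧y∉p⇒x≢y (p⊆⁅x⁆∪p b _ (p⊆⁅x⁆∪p a _ x∈Φ₀)) c∉Φ₂)
               (y∉⁅x⁆∪p (x∈p∧y∉p⇒x≢y (p⊆⁅x⁆∪p a _ x∈Φ₀) b∉Φ₁)
               (y∉⁅x⁆∪p (x∈p∧y∉p⇒x≢y x∈Φ₀ a∉Φ₀) (complete⇒∉ x~T)))

        ∣E∩F∣≡ : ∣ E ∩ F ∣ ≡ r ∸ 2
        ∣E∩F∣≡ = trans (cong ∣_∣ ([⁅x⁆∪⁅y⁆∪p]∩q≡p (c∉Φ₂ ∘ p⊆⁅x⁆∪p b _ ∘ F⊆Φ₁) (b∉Φ₁ ∘ F⊆Φ₁)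
                                   (⁅x⁆∪-monoʳ (p⊆⁅x⁆∪p u _ ∘ p⊆⁅x⁆∪p w T))))
                       (proj₂ (rclique-⁅⁆∪ T-rclique a~T))
          where
          F⊆Φ₁ : F ⊆ Φ₁
          F⊆Φ₁ = ⁅x⁆∪-monoʳ (p⊆⁅x⁆∪p x _)

        walkFromD : ∃ λ D → Good D × x ∈ D × Walk D
        walkFromD = D , D-good , x∈D , prepend (D-good , x∈D , ∣D∩E∣≡) (finalPair E-good F-good ∣E∩F∣≡ u∈F w∈F)
          where
          x∈D : x ∈ D
          x∈D = p⊆⁅x⁆∪p d _ (x∈⁅x⁆∪p x _)
          u∈F : u ∈ F
          u∈F = p⊆⁅x⁆∪p a _ (x∈⁅x⁆∪p u _)
          w∈F : w ∈ F
          w∈F = p⊆⁅x⁆∪p a _ (p⊆⁅x⁆∪p u _ (x∈⁅x⁆∪p w _))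

      edgeWalk : Adj u w → Adj v u → Adj v w → Adj v x → ∃ λ D → Good D × x ∈ D × Walk D
      edgeWalk u~w v~u v~w v~x =
        let T , _ , T-clique , T⊆Com , ∣T∣≡ = extend k {⁅ x ⁆ ∪ ⁅ u ⁆ ∪ ⁅ w ⁆} {⊥} ⊥-clique (⊥-elim ∘ ∉⊥) bound
        in  EdgeGadget.walkFromD u~w v~u v~w v~x (T-clique , trans ∣T∣≡ (cong (_+ k) (∣⊥∣≡0 n))) T⊆Com
        where
        ∣W∣≤3 : ∣ ⁅ x ⁆ ∪ ⁅ u ⁆ ∪ ⁅ w ⁆ ∣ ≤ 3
        ∣W∣≤3 = ∣p∣≤m⇒∣⁅x⁆∪p∣≤1+m x (∣p∣≤m⇒∣⁅x⁆∪p∣≤1+m u (≤-reflexive (∣⁅x⁆∣≡1 w)))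
        bound : ∣ ⁅ x ⁆ ∪ ⁅ u ⁆ ∪ ⁅ w ⁆ ∣ + ∣ ⊥ {n} ∣ + k ≤ 3 + k
        bound = +-monoˡ-≤ k (subst (λ s → ∣ ⁅ x ⁆ ∪ ⁅ u ⁆ ∪ ⁅ w ⁆ ∣ + s ≤ 3) (sym (∣⊥∣≡0 n))
                  (≤-trans (≤-reflexive (+-identityʳ _)) ∣W∣≤3))

lemma4p8 : (r n : ℕ) → 3 ≤ r → (G : Graph n) → MinDegreeCond G r →
    (v : Fin n) → (K : Subset n) → IsRClique G r K → K ⊆ N G v →
    (x : Fin n) → x ∈ K →
    (u w : Fin n) → Graph.Adj G u w → u ∈ N G v → w ∈ N G v →
    Σ ℕ λ m → Σ (ℕ → Subset n) λ Ks →
      1 ≤ m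
      × (∀ i → i < m → IsRClique G r (Ks i) × Ks i ⊆ N G v)
      × Ks 0 ≡ K
      × u ∈ Ks (m ∸ 1) × w ∈ Ks (m ∸ 1)
      × (∀ i → i + 2 < m → x ∈ Ks i)
      × (∀ i → i + 1 < m → ∣ Ks i ∩ Ks (i + 1) ∣ ≡ r ∸ 2)
lemma4p8 r n (s≤s (s≤s (s≤s z≤n))) G mindeg v K K-rclique K⊆N x x∈K u w u~w u∈N w∈N =
  let D , D-good , x∈D , walk = edgeWalk u w u~w (∈N⁻ G u∈N) (∈N⁻ G w∈N) (∈N⁻ G (K⊆N x∈K))
  in  walkAlong u w (chain r (K-rclique , K⊆N) D-good x∈K x∈D (m≤n+m r _)) walk
  where open Chains G mindeg v x using (chain; walkAlong; edgeWalk)
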